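{- Let $q$ be a prime power, $r^*=q^3-q$, $u^*=q^3+q^2$, and let $\Omega_{r,s_1,\dots,s_{q-1},t_1,\dots,t_{q-1},u}$ be as in the context. Assume $0\le s_\mu,t_\nu<q^2+q$ for all $\mu,\nu$ and $u\ge u^*$. Then \[\#\Omega_{r^*,0,s_2,\dots,s_{q-1},t_1,\dots,t_{q-1},u}=\#\Omega_{r^*,0,0,\dots,0,t_1,\dots,t_{q-1},u}+\sum_{\mu=2}^{q-1}s_\mu.\]
   Context: $q$ is a power of a prime. For integers $r,s_1,\dots,s_{q-1},t_1,\dots,t_{q-1},u$, $\Omega_{r,s_1,\dots,s_{q-1},t_1,\dots,t_{q-1},u}$ is the set of $(i,j_1,\dots,j_{q-1},k_1,\dots,k_{q-1})\in\mathbb{Z}^{2q-1}$ with $-r\le i$; $-s_\mu\le i+(q^2+q)k_\mu<-s_\mu+(q^2+q)$ for $1\le\mu\le q-1$; $-t_\nu\le qi+(q^2+q)j_\nu-(q+1)\sum_{\mu=1}^{q-1}k_\mu<-t_\nu+(q^2+q)$ for $1\le\nu\le q-1$; $-u\le -q^2i-(q^2+q)\sum_{\nu}j_\nu-(q+1)\sum_\mu k_\mu$. -}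

module Defs where

open import Data.Nat as ℕ using (ℕ)
open import Data.Nat.Primality using (Prime)
open import Data.Integer using (ℤ; +_; -_; _+_; _*_; _-_; _≤_; _<_)
open import Data.Fin using (Fin)
open import Data.Vec using (Vec; foldr; lookup; replicate)
open import Data.Vec.Relation.Binary.Pointwise.Inductive using (Pointwise)
open import Data.Product using (Σ; ∃; ∃-syntax; _×_)
open import Relation.Binary.PropositionalEquality using (_≡_)

IsPrimePower : ℕ → Set
IsPrimePower q = ∃[ p ] ∃[ k ] (Prime p × q ≡ p ℕ.^ ℕ.suc k)

sumℤ : ∀ {n} → Vec ℤ n → ℤ
sumℤ = foldr _ _+_ (+ 0)

Q : ℕ → ℤ
Q q = + (q ℕ.* q ℕ.+ q)

-- A point (i, j_1..j_{q-1}, k_1..k_{q-1}) ∈ ℤ^{2q-1}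
Point : ℕ → Set
Point q = ℤ × Vec ℤ (q ℕ.∸ 1) × Vec ℤ (q ℕ.∸ 1)

Window : ℕ → ℤ → ℤ → Set
Window q a x = (- a ≤ x) × (x < - a + Q q)

InΩ : (q : ℕ) → (r : ℤ) → (s t : Vec ℤ (q ℕ.∸ 1)) → (u : ℤ) → Point q → Set
InΩ q r s t u (i Data.Product., j Data.Product., k) =
  (- r ≤ i)
  × Pointwise (λ kμ sμ → Window q sμ (i + Q q * kμ)) k s
  × Pointwise (λ jν tν → Window q tν ((+ q) * i + Q q * jν - (+ (q ℕ.+ 1)) * sumℤ k)) j t
  × (- u ≤ - (+ (q ℕ.* q)) * i - Q q * sumℤ j - (+ (q ℕ.+ 1)) * sumℤ k)

Ω : (q : ℕ) → (r : ℤ) → (s t : Vec ℤ (q ℕ.∸ 1)) → (u : ℤ) → Set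
Ω q r s t u = Σ (Point q) (InΩ q r s t u)

rStar : ℕ → ℤ
rStar q = + (q ℕ.* q ℕ.* q) - + q

uStar : ℕ → ℤ
uStar q = + (q ℕ.* q ℕ.* q ℕ.+ q ℕ.* q)

zeros : (q : ℕ) → Vec ℤ (q ℕ.∸ 1)
zeros q = replicate (q ℕ.∸ 1) (+ 0)

-- For a bound a and x ∈ ℤ there is exactly one κ a x ∈ ℤ with x + d·κ a x in the
-- window [-a, -a + d).  Hence a point of Ω is determined by its first coordinate i: the
-- k_μ are κ s_μ i, and then the j_ν are κ t_ν X with X = qi - (q+1)Σk.  So Ω is the set of
-- i ≥ -r* whose "energy" (the last linear form at the forced point) is ≥ -u.  Writing
-- i = ρ + d(n + c) with 0 ≤ ρ < d and c the number of carries ρ + s_μ ≥ d, the energy no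
-- longer depends on s, and i ≥ -r* = -pd becomes n ≥ -p - c.  The reduced energy is ≥ -u*
-- for n < -p and < -u for n large, so each fibre over ρ is a finite set plus exactly c
-- extra points.  Summing over ρ, the carries add up to Σ_μ s_μ.
module Submission where

open import Defs
open import Data.Nat as ℕ using (ℕ)
open import Data.Integer using (ℤ; +_; _+_; _≤_; _<_)
open import Data.Fin using (Fin; toℕ)
open import Data.Vec using (Vec; lookup)
open import Data.Product using (∃-syntax; _×_)
open import Function.Bundles using (_↔_)
open import Relation.Binary.PropositionalEquality using (_≡_)

open import Data.Nat using (zero; suc)
import Data.Nat.Properties as ℕP
open import Data.Nat.DivMod using (_/_; m<n⇒m/n≡0; m/n≡1+[m∸n]/n)
open import Data.Nat.Primality using (Prime; ¬prime[0])
open import Data.Integer as ℤ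
  using (+[1+_]; -[1+_]; -_; _-_; _*_; ∣_∣; +≤+; +<+; _/ℕ_; _%ℕ_)
import Data.Integer.Properties as ℤP
open import Data.Integer.DivMod using (a≡a%ℕn+[a/ℕn]*n; n%ℕd<d)
open import Data.Integer.Tactic.RingSolver using (solve-∀)
open import Data.Fin as Fin using (fromℕ<)
open import Data.Fin.Properties using (+↔⊎; toℕ-fromℕ<; toℕ<n; toℕ-injective)
open import Data.Vec using ([]; _∷_; map; replicate)
open import Data.Vec.Properties using (lookup-replicate)
open import Data.Vec.Relation.Binary.Pointwise.Inductive using (Pointwise; []; _∷_)
open import Data.Product using (Σ; _,_; proj₁; proj₂; uncurry)
open import Data.Product.Algebra using (Σ-assoc)
open import Data.Product.Function.Dependent.Propositional using (Σ-↔)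
open import Data.Sum using (_⊎_; inj₁; inj₂)
open import Data.Sum.Algebra using (⊎-cong)
open import Data.Empty using (⊥; ⊥-elim)
open import Function using (_∘_)
open import Function.Bundles using (mk↔ₛ′)
open import Function.Construct.Composition using (_↔-∘_)
open import Function.Construct.Symmetry using (↔-sym)
open import Function.Properties.Inverse using (↔-refl)
open import Function.Related.Propositional using (module EquationalReasoning; bijection)
open import Relation.Binary.PropositionalEquality
open import Relation.Nullary using (¬_; yes; no; Irrelevant)
open import Relation.Unary using (Decidable)
open import Algebra.Properties.CommutativeMonoid.Sum ℕP.+-0-commutativeMonoid
  using (sum; ∑-distrib-+; sum-cong-≗; sum-replicate-zero)

≤-by : ∀ {a b e} → + 0 ≤ e → b - a ≡ e → a ≤ b
≤-by 0≤e eq = ℤP.0≤i-j⇒j≤i (subst (+ 0 ≤_) (sym eq) 0≤e)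

<-by : ∀ {a b e} → + 0 ≤ e → b - (+ 1 + a) ≡ e → a < b
<-by 0≤e eq = ℤP.suc[i]≤j⇒i<j (≤-by 0≤e eq)

gap≤ : ∀ {a b} → a ≤ b → + 0 ≤ b - a
gap≤ = ℤP.i≤j⇒0≤j-i

gap< : ∀ {a b} → a < b → + 0 ≤ b - (+ 1 + a)
gap< a<b = ℤP.i≤j⇒0≤j-i (ℤP.i<j⇒suc[i]≤j a<b)

0≤+ : ∀ n → + 0 ≤ + n
0≤+ n = +≤+ ℕ.z≤n

0≤-+ : ∀ {x y} → + 0 ≤ x → + 0 ≤ y → + 0 ≤ x + y
0≤-+ = ℤP.+-mono-≤

0≤-* : ∀ {x y} → + 0 ≤ x → + 0 ≤ y → + 0 ≤ x * y
0≤-* {+ m} {+ n} _ _ = subst (+ 0 ≤_) (ℤP.pos-* m n) (0≤+ (m ℕ.* n))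

Σ-Fin-suc : ∀ {n} (A : Fin (suc n) → Set) →
            Σ (Fin (suc n)) A ↔ (A Fin.zero ⊎ Σ (Fin n) (A ∘ Fin.suc))
Σ-Fin-suc {n} A = mk↔ₛ′ split join split∘join join∘split
  where
    split : Σ (Fin (suc n)) A → A Fin.zero ⊎ Σ (Fin n) (A ∘ Fin.suc)
    split (Fin.zero  , a) = inj₁ a
    split (Fin.suc ρ , a) = inj₂ (ρ , a)
    join : A Fin.zero ⊎ Σ (Fin n) (A ∘ Fin.suc) → Σ (Fin (suc n)) A
    join (inj₁ a)       = Fin.zero , a
    join (inj₂ (ρ , a)) = Fin.suc ρ , a
    split∘join : ∀ y → split (join y) ≡ y
    split∘join (inj₁ a) = refl
    split∘join (inj₂ _) = refl
    join∘split : ∀ x → join (split x) ≡ x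
    join∘split (Fin.zero  , _) = refl
    join∘split (Fin.suc _ , _) = refl

Σ-Fin↔sum : ∀ n {A : Fin n → Set} (size : Fin n → ℕ) →
            (∀ ρ → A ρ ↔ Fin (size ρ)) → Σ (Fin n) A ↔ Fin (sum size)
Σ-Fin↔sum zero    size count = mk↔ₛ′ (λ { (() , _) }) (λ ()) (λ ()) (λ { (() , _) })
Σ-Fin↔sum (suc n) size count =
  ↔-sym +↔⊎ ↔-∘ (⊎-cong (count Fin.zero) (Σ-Fin↔sum n (size ∘ Fin.suc) (count ∘ Fin.suc))
                 ↔-∘ Σ-Fin-suc _)

indicator≤ : ℕ → ℕ → ℕ
indicator≤ zero    x       = 1
indicator≤ (suc b) zero    = 0
indicator≤ (suc b) (suc x) = indicator≤ b x

indicator-yes : ∀ {b x} → b ℕ.≤ x → indicator≤ b x ≡ 1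
indicator-yes {zero}          _            = refl
indicator-yes {suc b} {suc x} (ℕ.s≤s b≤x) = indicator-yes b≤x

indicator-no : ∀ {b x} → x ℕ.< b → indicator≤ b x ≡ 0
indicator-no {suc b} {zero}  _            = refl
indicator-no {suc b} {suc x} (ℕ.s≤s x<b) = indicator-no x<b

count-≥ : ∀ n b → sum (λ (ρ : Fin n) → indicator≤ b (toℕ ρ)) ≡ n ℕ.∸ b
count-≥ zero    b       = sym (ℕP.0∸n≡0 b)
count-≥ (suc n) zero    = cong suc (count-≥ n zero)
count-≥ (suc n) (suc b) = count-≥ n b

module HalfLine (P : ℤ → Set) (P-irrelevant : ∀ {n} → Irrelevant (P n)) (P? : Decidable P) where

  AtLeast : ℤ → Set
  AtLeast lo = Σ ℤ (λ n → (lo ≤ n) × P n)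

  AtLeast-≡ : ∀ {lo n n'} {l : lo ≤ n} {l' : lo ≤ n'} {x : P n} {x' : P n'} →
              n ≡ n' → _≡_ {A = AtLeast lo} (n , l , x) (n' , l' , x')
  AtLeast-≡ {l = l} {l'} {x} {x'} refl
    rewrite ℤP.≤-irrelevant l l' | P-irrelevant x x' = refl

  peel : ∀ lo → AtLeast lo ↔ (P lo ⊎ AtLeast (ℤ.suc lo))
  peel lo = mk↔ₛ′ split join split∘join join∘split
    where
      split : AtLeast lo → P lo ⊎ AtLeast (ℤ.suc lo)
      split (n , l , x) with n ℤP.≟ lo
      ... | yes refl = inj₁ x
      ... | no n≢lo  = inj₂ (n , ℤP.i<j⇒suc[i]≤j (ℤP.≤∧≢⇒< l (n≢lo ∘ sym)) , x)
      join : P lo ⊎ AtLeast (ℤ.suc lo) → AtLeast lo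
      join (inj₁ x)           = lo , ℤP.≤-refl , x
      join (inj₂ (n , l , x)) = n , ℤP.≤-trans (ℤP.i≤suc[i] lo) l , x
      split∘join : ∀ y → split (join y) ≡ y
      split∘join (inj₁ x) with lo ℤP.≟ lo
      ... | yes refl = refl
      ... | no lo≢lo = ⊥-elim (lo≢lo refl)
      split∘join (inj₂ (n , l , x)) with n ℤP.≟ lo
      ... | yes refl = ⊥-elim (ℤP.<-irrefl refl (ℤP.suc[i]≤j⇒i<j l))
      ... | no _     = cong inj₂ (AtLeast-≡ refl)
      join∘split : ∀ x → join (split x) ≡ x
      join∘split (n , l , x) with n ℤP.≟ lo
      ... | yes refl = AtLeast-≡ refl
      ... | no _     = AtLeast-≡ refl

  AtLeast-cong : ∀ {lo lo'} → lo ≡ lo' → AtLeast lo ↔ AtLeast lo'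
  AtLeast-cong refl = ↔-refl

  holds↔ : ∀ {n} → P n → P n ↔ Fin 1
  holds↔ x = mk↔ₛ′ (λ _ → Fin.zero) (λ _ → x)
                   (λ { Fin.zero → refl ; (Fin.suc ()) }) (P-irrelevant x)

  fails↔ : ∀ {n} → ¬ P n → P n ↔ Fin 0
  fails↔ ¬x = mk↔ₛ′ (⊥-elim ∘ ¬x) (λ ()) (λ ()) (⊥-elim ∘ ¬x)

  finite-by : ∀ L lo → (∀ n → lo + + L ≤ n → ¬ P n) → ∃[ k ] (AtLeast lo ↔ Fin k)
  finite-by zero lo none = 0 , mk↔ₛ′ (⊥-elim ∘ empty) (λ ()) (λ ()) (⊥-elim ∘ empty)
    where
      empty : AtLeast lo → ⊥
      empty (n , l , x) = none n (subst (_≤ n) (sym (ℤP.+-identityʳ lo)) l) x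
  finite-by (suc L) lo none with finite-by L (ℤ.suc lo) (λ n → none n ∘ subst (_≤ n) (shift lo (+ L)))
    where
      shift : ∀ lo L → (+ 1 + lo) + L ≡ lo + (+ 1 + L)
      shift = solve-∀
  ... | k , rest with P? lo
  ... | yes x = suc k , (↔-sym +↔⊎ ↔-∘ (⊎-cong (holds↔ x) rest ↔-∘ peel lo))
  ... | no ¬x = k     , (↔-sym +↔⊎ ↔-∘ (⊎-cong (fails↔ ¬x) rest ↔-∘ peel lo))

  finite : ∀ lo hi → lo ≤ hi → (∀ n → hi ≤ n → ¬ P n) → ∃[ k ] (AtLeast lo ↔ Fin k)
  finite lo hi lo≤hi none = finite-by ∣ hi - lo ∣ lo (λ n → none n ∘ subst (_≤ n) reach)
    where
      cancel : ∀ lo hi → lo + (hi - lo) ≡ hi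
      cancel = solve-∀
      reach : lo + + ∣ hi - lo ∣ ≡ hi
      reach = trans (cong (λ z → lo + z) (ℤP.0≤i⇒+∣i∣≡i (gap≤ lo≤hi))) (cancel lo hi)

  extend : ∀ lo c {k} → (∀ n → n < lo → P n) →
           AtLeast lo ↔ Fin k → AtLeast (lo - + c) ↔ Fin (c ℕ.+ k)
  extend lo zero    below fin = fin ↔-∘ AtLeast-cong (ℤP.+-identityʳ lo)
  extend lo (suc c) below fin =
    ↔-sym +↔⊎ ↔-∘ (⊎-cong (holds↔ (below (lo - + suc c) lowest<lo))
                          (extend lo c below fin ↔-∘ AtLeast-cong (next lo (+ c)))
                   ↔-∘ peel (lo - + suc c))
    where
      next : ∀ lo c → + 1 + (lo - (+ 1 + c)) ≡ lo - c
      next = solve-∀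
      gap : ∀ lo c → lo - (+ 1 + (lo - (+ 1 + c))) ≡ c
      gap = solve-∀
      lowest<lo : lo - + suc c < lo
      lowest<lo = <-by (0≤+ c) (gap lo (+ c))

-- Windows of width d.  InWindow a x says -a ≤ x < -a + d (Defs.Window q is InWindow for
-- d = q² + q).  For every a and x there is exactly one κ a x with x + d·κ a x in the window.
module Windows (d : ℕ) .{{_ : ℕ.NonZero d}} where

  InWindow : ℤ → ℤ → Set
  InWindow a x = (- a ≤ x) × (x < - a + + d)

  κ : ℤ → ℤ → ℤ
  κ a x = - ((x + a) /ℕ d)

  κ-residue : ∀ a x → x + + d * κ a x ≡ + ((x + a) %ℕ d) - a
  κ-residue a x = begin
      x + D * - quot                   ≡⟨ regroup x a D quot ⟩
      (x + a) - a - quot * D           ≡⟨ cong (λ z → z - a - quot * D) (a≡a%ℕn+[a/ℕn]*n (x + a) d) ⟩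
      (+ rem + quot * D) - a - quot * D ≡⟨ cancel (+ rem) a D quot ⟩
      + rem - a                        ∎
    where
      open ≡-Reasoning
      D = + d
      quot = (x + a) /ℕ d
      rem = (x + a) %ℕ d
      regroup : ∀ x a D k → x + D * - k ≡ (x + a) - a - k * D
      regroup = solve-∀
      cancel : ∀ r a D k → (r + k * D) - a - k * D ≡ r - a
      cancel = solve-∀

  κ-window : ∀ a x → InWindow a (x + + d * κ a x)
  κ-window a x = subst (InWindow a) (sym (κ-residue a x))
    (≤-by (0≤+ rem) (e₁ (+ rem) a) , <-by (gap< (+<+ (n%ℕd<d (x + a) d))) (e₂ (+ rem) a (+ d)))
    where
      rem = (x + a) %ℕ d
      e₁ : ∀ r a → r - a - - a ≡ r
      e₁ = solve-∀
      e₂ : ∀ r a D → - a + D - (+ 1 + (r - a)) ≡ D - (+ 1 + r)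
      e₂ = solve-∀

  small-multiple : ∀ m → - + d < + d * m → + d * m < + d → m ≡ + 0
  small-multiple (+ 0)    _      _    = refl
  small-multiple +[1+ n ] _      dm<d =
    ⊥-elim (ℤP.<⇒≱ dm<d (≤-by (0≤-* (0≤+ d) (0≤+ n)) (e (+ d) (+ n))))
    where
      e : ∀ D n → D * (+ 1 + n) - D ≡ D * n
      e = solve-∀
  small-multiple -[1+ n ] -d<dm _    =
    ⊥-elim (ℤP.<⇒≱ -d<dm (≤-by (0≤-* (0≤+ d) (0≤+ n)) (e (+ d) (+ n))))
    where
      e : ∀ D n → - D - D * - (+ 1 + n) ≡ D * n
      e = solve-∀

  κ-unique : ∀ a x k → InWindow a (x + + d * k) → k ≡ κ a x
  κ-unique a x k (lo , hi) = ℤP.i-j≡0⇒i≡j k k₀ (small-multiple (k - k₀)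
      (<-by (0≤-+ (gap< hi₀) (gap≤ lo)) (e₁ a x (+ d) k k₀))
      (<-by (0≤-+ (gap< hi) (gap≤ lo₀)) (e₂ a x (+ d) k k₀)))
    where
      k₀ = κ a x
      lo₀ = proj₁ (κ-window a x)
      hi₀ = proj₂ (κ-window a x)
      e₁ : ∀ a x D k k₀ → D * (k - k₀) - (+ 1 + - D)
                         ≡ ((- a + D) - (+ 1 + (x + D * k₀))) + ((x + D * k) - - a)
      e₁ = solve-∀
      e₂ : ∀ a x D k k₀ → D - (+ 1 + D * (k - k₀))
                         ≡ ((- a + D) - (+ 1 + (x + D * k))) + ((x + D * k₀) - - a)
      e₂ = solve-∀

  κ-shift : ∀ a x z → κ a (x + + d * z) ≡ κ a x - z
  κ-shift a x z = sym (κ-unique a (x + + d * z) (κ a x - z)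
    (subst (InWindow a) (e x (+ d) z (κ a x)) (κ-window a x)))
    where
      e : ∀ x D z k → x + D * k ≡ x + D * z + D * (k - z)
      e = solve-∀

  κ-combine : ∀ a ρ m → κ (+ a) (+ ρ + + d * m) ≡ - + ((ρ ℕ.+ a) / d) - m
  κ-combine a ρ m = κ-shift (+ a) (+ ρ) m

  division-unique : ∀ {ρ r m m'} → ρ ℕ.< d → r ℕ.< d → + ρ + + d * m ≡ + r + + d * m' → m ≡ m'
  division-unique {ρ} {r} {m} {m'} ρ<d r<d eq = ℤP.neg-injective
    (trans (κ-unique (+ 0) x (- m)  (window ρ<d (e (+ ρ) (+ d) m refl)))
      (sym (κ-unique (+ 0) x (- m') (window r<d (e (+ r) (+ d) m' eq)))))
    where
      x = + ρ + + d * m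
      window : ∀ {n y} → n ℕ.< d → + n ≡ y → InWindow (+ 0) y
      window n<d refl = 0≤+ _ , +<+ n<d
      cancel : ∀ r D k → r ≡ (r + D * k) + D * - k
      cancel = solve-∀
      e : ∀ {x} r D k → x ≡ r + D * k → r ≡ x + D * - k
      e r D k refl = cancel r D k

  divMod-split : ∀ i → + (i %ℕ d) + + d * (i /ℕ d) ≡ i
  divMod-split i = trans (swap (+ (i %ℕ d)) (+ d) (i /ℕ d)) (sym (a≡a%ℕn+[a/ℕn]*n i d))
    where
      swap : ∀ r D k → r + D * k ≡ r + k * D
      swap = solve-∀

  quotient-combine : ∀ {ρ} m → ρ ℕ.< d → (+ ρ + + d * m) /ℕ d ≡ m
  quotient-combine {ρ} m ρ<d =
    sym (division-unique ρ<d (n%ℕd<d i d) (sym (divMod-split i)))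
    where i = + ρ + + d * m

  combine↔ : (Fin d × ℤ) ↔ ℤ
  combine↔ = mk↔ₛ′ combine split combine∘split split∘combine
    where
      combine : Fin d × ℤ → ℤ
      combine (ρ , m) = + toℕ ρ + + d * m
      split : ℤ → Fin d × ℤ
      split i = fromℕ< (n%ℕd<d i d) , i /ℕ d
      combine∘split : ∀ i → combine (split i) ≡ i
      combine∘split i rewrite toℕ-fromℕ< (n%ℕd<d i d) = divMod-split i
      split∘combine : ∀ x → split (combine x) ≡ x
      split∘combine (ρ , m) = cong₂ _,_ (toℕ-injective (trans (toℕ-fromℕ< _) rem≡)) quot≡
        where
          i = + toℕ ρ + + d * m
          quot≡ : i /ℕ d ≡ m
          quot≡ = quotient-combine m (toℕ<n ρ)
          cancel : ∀ r D k → (r + D * k) - D * k ≡ r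
          cancel = solve-∀
          rem≡ : i %ℕ d ≡ toℕ ρ
          rem≡ = ℤP.+-injective (begin
            + (i %ℕ d)                              ≡⟨ cancel (+ (i %ℕ d)) (+ d) m ⟨
            (+ (i %ℕ d) + + d * m) - + d * m        ≡⟨ cong (λ k → (+ (i %ℕ d) + + d * k) - + d * m) quot≡ ⟨
            (+ (i %ℕ d) + + d * (i /ℕ d)) - + d * m ≡⟨ cong (_- + d * m) (divMod-split i) ⟩
            i - + d * m                             ≡⟨ cancel (+ toℕ ρ) (+ d) m ⟩
            + toℕ ρ                                 ∎)
            where open ≡-Reasoning

  nonneg-quotient : ∀ {ρ} m → ρ ℕ.< d → + 0 ≤ + ρ + + d * m → + 0 ≤ m
  nonneg-quotient m ρ<d 0≤i = subst (+ 0 ≤_) (quotient-combine m ρ<d) (nonneg-/ℕ 0≤i)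
    where
      nonneg-/ℕ : ∀ {i} → + 0 ≤ i → + 0 ≤ i /ℕ d
      nonneg-/ℕ (+≤+ _) = 0≤+ _

  κs : ∀ {n} → Vec ℤ n → ℤ → Vec ℤ n
  κs as x = map (λ a → κ a x) as

  WindowConditions : ∀ {n} → (ℤ → ℤ) → Vec ℤ n → Vec ℤ n → Set
  WindowConditions f ks as = Pointwise (λ k a → InWindow a (f k)) ks as

  windows-exist : ∀ {n} {f : ℤ → ℤ} x → (∀ k → f k ≡ x + + d * k) → (as : Vec ℤ n) →
                  WindowConditions f (κs as x) as
  windows-exist x f≡ []       = []
  windows-exist x f≡ (a ∷ as) =
    subst (InWindow a) (sym (f≡ (κ a x))) (κ-window a x) ∷ windows-exist x f≡ as

  windows-unique : ∀ {n} {f : ℤ → ℤ} {ks as : Vec ℤ n} x → (∀ k → f k ≡ x + + d * k) →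
                   WindowConditions f ks as → ks ≡ κs as x
  windows-unique x f≡ []                  = refl
  windows-unique x f≡ (_∷_ {x = k} w ws) =
    cong₂ _∷_ (κ-unique _ x k (subst (InWindow _) (f≡ k) w)) (windows-unique x f≡ ws)

  windows-irrelevant : ∀ {n} {f : ℤ → ℤ} {ks as : Vec ℤ n} → Irrelevant (WindowConditions f ks as)
  windows-irrelevant []               []               = refl
  windows-irrelevant ((l , h) ∷ ws) ((l' , h') ∷ ws') =
    cong₂ _∷_ (cong₂ _,_ (ℤP.≤-irrelevant l l') (ℤP.<-irrelevant h h')) (windows-irrelevant ws ws')

  Bounded : ∀ {n} → Vec ℤ n → Set
  Bounded {n} as = (μ : Fin n) → (+ 0 ≤ lookup as μ) × (lookup as μ < + d)

  -- carries as ρ counts the a ∈ as with ρ + a ≥ d: the carries when adding a to ρ < d.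
  carries : ∀ {n} → Vec ℤ n → ℕ → ℕ
  carries []       ρ = 0
  carries (a ∷ as) ρ = (ρ ℕ.+ ∣ a ∣) / d ℕ.+ carries as ρ

  -- Summing the κ's at ρ + dm: each contributes -m, and -1 more for every carry.
  κs-sum-combine : ∀ {n} (as : Vec ℤ n) → Bounded as → ∀ ρ m →
                   sumℤ (κs as (+ ρ + + d * m)) ≡ - (+ n * m) - + carries as ρ
  κs-sum-combine []              _  ρ m = e m
    where
      e : ∀ m → + 0 ≡ - (+ 0 * m) - + 0
      e = solve-∀
  κs-sum-combine {suc n} (+ a ∷ as) bd ρ m = begin
      κ (+ a) i + sumℤ (κs as i)
        ≡⟨ cong₂ _+_ (κ-combine a ρ m) (κs-sum-combine as (bd ∘ Fin.suc) ρ m) ⟩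
      (- + c - m) + (- (+ n * m) - + C)
        ≡⟨ e (+ c) (+ C) (+ n) m ⟩
      - (+ suc n * m) - (+ c + + C)
        ≡⟨ cong (λ z → - (+ suc n * m) - z) (ℤP.pos-+ c C) ⟨
      - (+ suc n * m) - + (c ℕ.+ C)
        ∎
    where
      open ≡-Reasoning
      i = + ρ + + d * m
      c = (ρ ℕ.+ a) / d
      C = carries as ρ
      e : ∀ c C n m → (- c - m) + (- (n * m) - C) ≡ - ((+ 1 + n) * m) - (c + C)
      e = solve-∀
  κs-sum-combine (-[1+ _ ] ∷ _) bd ρ m with proj₁ (bd Fin.zero)
  ... | ()

  κs-sum-shift : ∀ {n} (as : Vec ℤ n) x z → sumℤ (κs as (x + + d * z)) ≡ sumℤ (κs as x) - + n * z
  κs-sum-shift []       x z = e z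
    where
      e : ∀ z → + 0 ≡ + 0 - + 0 * z
      e = solve-∀
  κs-sum-shift {suc n} (a ∷ as) x z =
    trans (cong₂ _+_ (κ-shift a x z) (κs-sum-shift as x z)) (e (κ a x) (sumℤ (κs as x)) z (+ n))
    where
      e : ∀ k K z n → (k - z) + (K - n * z) ≡ (k + K) - (+ 1 + n) * z
      e = solve-∀

  residue-sum : ∀ {n} → Vec ℤ n → ℤ → ℤ
  residue-sum {n} as x = + n * x + + d * sumℤ (κs as x)

  -- For bounds in [0, d) each representative lies in [-d, d].
  residue-sum-bounds : ∀ {n} (as : Vec ℤ n) → Bounded as → ∀ x →
    (- (+ n * + d) ≤ residue-sum as x) × (residue-sum as x ≤ + n * + d)
  residue-sum-bounds []       _  x = ≤-by (0≤+ 0) (e₁ x (+ d)) , ≤-by (0≤+ 0) (e₂ x (+ d))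
    where
      e₁ : ∀ x D → (+ 0 * x + D * + 0) - - (+ 0 * D) ≡ + 0
      e₁ = solve-∀
      e₂ : ∀ x D → + 0 * D - (+ 0 * x + D * + 0) ≡ + 0
      e₂ = solve-∀
  residue-sum-bounds {suc n} (a ∷ as) bd x =
      ≤-by (0≤-+ (gap≤ (proj₁ rest)) (0≤-+ (gap≤ lo) (gap≤ (ℤP.<⇒≤ a<d)))) (e₁ (+ n) x (+ d) K k a)
    , ≤-by (0≤-+ (gap≤ (proj₂ rest)) (0≤-+ (gap< hi) (0≤-+ 0≤a (0≤+ 1)))) (e₂ (+ n) x (+ d) K k a)
    where
      rest = residue-sum-bounds as (bd ∘ Fin.suc) x
      0≤a = proj₁ (bd Fin.zero)
      a<d = proj₂ (bd Fin.zero)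
      k = κ a x
      K = sumℤ (κs as x)
      lo = proj₁ (κ-window a x)
      hi = proj₂ (κ-window a x)
      e₁ : ∀ n x D K k a → ((+ 1 + n) * x + D * (k + K)) - - ((+ 1 + n) * D)
                          ≡ ((n * x + D * K) - - (n * D)) + (((x + D * k) - - a) + (D - a))
      e₁ = solve-∀
      e₂ : ∀ n x D K k a → (+ 1 + n) * D - ((+ 1 + n) * x + D * (k + K))
                          ≡ (n * D - (n * x + D * K)) + (((- a + D) - (+ 1 + (x + D * k))) + (a + + 1))
      e₂ = solve-∀

  carry-indicator : ∀ {ρ a} → ρ ℕ.< d → a ℕ.≤ d → (ρ ℕ.+ a) / d ≡ indicator≤ (d ℕ.∸ a) ρ
  carry-indicator {ρ} {a} ρ<d a≤d with d ℕ.∸ a ℕ.≤? ρ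
  ... | yes d-a≤ρ = begin
      (ρ ℕ.+ a) / d             ≡⟨ m/n≡1+[m∸n]/n d≤ρ+a ⟩
      suc ((ρ ℕ.+ a ℕ.∸ d) / d) ≡⟨ cong suc (m<n⇒m/n≡0 ρ+a-d<d) ⟩
      1                         ≡⟨ indicator-yes d-a≤ρ ⟨
      indicator≤ (d ℕ.∸ a) ρ    ∎
    where
      open ≡-Reasoning
      d≤ρ+a : d ℕ.≤ ρ ℕ.+ a
      d≤ρ+a = subst (ℕ._≤ ρ ℕ.+ a) (ℕP.m∸n+n≡m a≤d) (ℕP.+-monoˡ-≤ a d-a≤ρ)
      ρ+a-d<d : ρ ℕ.+ a ℕ.∸ d ℕ.< d
      ρ+a-d<d = ℕP.m<n+o⇒m∸n<o (ρ ℕ.+ a) d (ℕP.+-mono-<-≤ ρ<d a≤d)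
  ... | no d-a≰ρ = trans (m<n⇒m/n≡0 (ℕP.m≤o∸n⇒m+n≤o (suc ρ) a≤d ρ<d-a)) (sym (indicator-no ρ<d-a))
    where
      ρ<d-a : ρ ℕ.< d ℕ.∸ a
      ρ<d-a = ℕP.≰⇒> d-a≰ρ

  carry-sum : ∀ {a} → a ℕ.≤ d → sum (λ (ρ : Fin d) → (toℕ ρ ℕ.+ a) / d) ≡ a
  carry-sum {a} a≤d = begin
    sum (λ (ρ : Fin d) → (toℕ ρ ℕ.+ a) / d)  ≡⟨ sum-cong-≗ (λ ρ → carry-indicator (toℕ<n ρ) a≤d) ⟩
    sum (λ (ρ : Fin d) → indicator≤ (d ℕ.∸ a) (toℕ ρ))
                                              ≡⟨ count-≥ d (d ℕ.∸ a) ⟩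
    d ℕ.∸ (d ℕ.∸ a)                           ≡⟨ ℕP.m∸[m∸n]≡n a≤d ⟩
    a                                         ∎
    where open ≡-Reasoning

  total-carries : ∀ {n} (as : Vec ℤ n) → Bounded as →
                  + sum (λ (ρ : Fin d) → carries as (toℕ ρ)) ≡ sumℤ as
  total-carries []         _  = cong +_ (sum-replicate-zero d)
  total-carries (+ a ∷ as) bd = begin
      + sum (λ (ρ : Fin d) → carry ρ ℕ.+ rest ρ) ≡⟨ cong +_ (∑-distrib-+ carry rest) ⟩
      + (sum carry ℕ.+ sum rest)            ≡⟨ ℤP.pos-+ (sum carry) (sum rest) ⟩
      + sum carry + + sum rest
        ≡⟨ cong₂ _+_ (cong +_ (carry-sum a≤d)) (total-carries as (bd ∘ Fin.suc)) ⟩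
      + a + sumℤ as                         ∎
    where
      open ≡-Reasoning
      carry rest : Fin d → ℕ
      carry ρ = (toℕ ρ ℕ.+ a) / d
      rest ρ = carries as (toℕ ρ)
      a≤d : a ℕ.≤ d
      a≤d with proj₂ (bd Fin.zero)
      ... | +<+ a<d = ℕP.<⇒≤ a<d
  total-carries (-[1+ _ ] ∷ _) bd with proj₁ (bd Fin.zero)
  ... | ()

props↔ : ∀ {A B : Set} → Irrelevant A → Irrelevant B → (A → B) → (B → A) → A ↔ B
props↔ A-irr B-irr to from = mk↔ₛ′ to from (λ _ → B-irr _ _) (λ _ → A-irr _ _)

≤×≤-irrelevant : ∀ {a b c e} → Irrelevant ((a ≤ b) × (c ≤ e))
≤×≤-irrelevant (x , y) (x' , y') = cong₂ _,_ (ℤP.≤-irrelevant x x') (ℤP.≤-irrelevant y y')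

shift↔ : ℤ → ℤ ↔ ℤ
shift↔ c = mk↔ₛ′ (_+ c) (_- c) (cancel₁ c) (cancel₂ c)
  where
    cancel₁ : ∀ c n → n - c + c ≡ n
    cancel₁ = solve-∀
    cancel₂ : ∀ c n → n + c - c ≡ n
    cancel₂ = solve-∀

module Structure (p : ℕ) (t : Vec ℤ p) where

  q d : ℕ
  q = suc p
  d = q ℕ.* q ℕ.+ q

  open Windows d public

  -- The linear forms of Ω at a point (i, j, k): the j-windows are centred on X-at i k,
  -- and energy-at i j k is the form bounded below by -u.
  X-at : ℤ → Vec ℤ p → ℤ
  X-at i k = + q * i - + (q ℕ.+ 1) * sumℤ k

  energy-at : ℤ → Vec ℤ p → Vec ℤ p → ℤ
  energy-at i j k = - + (q ℕ.* q) * i - Q q * sumℤ j - + (q ℕ.+ 1) * sumℤ k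

  -- For given i the unknowns are forced: k = κs s i, then j = κs t (X s i).
  X : Vec ℤ p → ℤ → ℤ
  X s i = X-at i (κs s i)

  energy : Vec ℤ p → ℤ → ℤ
  energy s i = energy-at i (κs t (X s i)) (κs s i)

  Ω-by-i : ∀ r s u → Ω q r s t u ↔ Σ ℤ (λ i → (- r ≤ i) × (- u ≤ energy s i))
  Ω-by-i r s u = mk↔ₛ′ first point first∘point point∘first
    where
      j-shape : ∀ i k j → + q * i + Q q * j - + (q ℕ.+ 1) * sumℤ k ≡ X-at i k + + d * j
      j-shape i k j = e (+ q) i (sumℤ k) j (+ (q ℕ.+ 1)) (Q q)
        where
          e : ∀ q i K j Q D → q * i + D * j - Q * K ≡ (q * i - Q * K) + D * j
          e = solve-∀
      forced : ∀ {i j k} → InΩ q r s t u (i , j , k) → (j ≡ κs t (X s i)) × (k ≡ κs s i)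
      forced {i} {j} {k} (_ , wk , wj , _) =
        trans (windows-unique (X-at i k) (j-shape i k) wj) (cong (κs t ∘ X-at i) k≡) , k≡
        where
          k≡ = windows-unique i (λ _ → refl) wk
      first : Ω q r s t u → Σ ℤ (λ i → (- r ≤ i) × (- u ≤ energy s i))
      first ((i , j , k) , in-Ω@(r≤i , _ , _ , u≤)) =
        i , r≤i , subst₂ (λ j k → - u ≤ energy-at i j k) (proj₁ (forced in-Ω)) (proj₂ (forced in-Ω)) u≤
      point : Σ ℤ (λ i → (- r ≤ i) × (- u ≤ energy s i)) → Ω q r s t u
      point (i , r≤i , u≤) = (i , κs t (X s i) , κs s i) ,
        r≤i , windows-exist i (λ _ → refl) s , windows-exist (X s i) (j-shape i (κs s i)) t , u≤
      InΩ-irrelevant : ∀ {x} → Irrelevant (InΩ q r s t u x)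
      InΩ-irrelevant (a , b , c , e) (a' , b' , c' , e') =
        cong₂ _,_ (ℤP.≤-irrelevant a a')
          (cong₂ _,_ (windows-irrelevant b b') (cong₂ _,_ (windows-irrelevant c c') (ℤP.≤-irrelevant e e')))
      first∘point : ∀ y → first (point y) ≡ y
      first∘point (i , r≤i , u≤) = cong (λ z → i , r≤i , z) (ℤP.≤-irrelevant _ _)
      Ω-≡ : ∀ {x y} {in-x : InΩ q r s t u x} {in-y : InΩ q r s t u y} →
            x ≡ y → _≡_ {A = Ω q r s t u} (x , in-x) (y , in-y)
      Ω-≡ refl = cong (_ ,_) (InΩ-irrelevant _ _)
      point∘first : ∀ x → point (first x) ≡ x
      point∘first ((i , j , k) , in-Ω) =
        Ω-≡ (cong (i ,_) (sym (cong₂ _,_ (proj₁ (forced in-Ω)) (proj₂ (forced in-Ω)))))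

  -- Write i = ρ + d(n + c) with c = carries s ρ.  Then the forced data no longer depend on s:
  -- X becomes X₀ ρ n up to a multiple of d, and the energy becomes reduced-energy ρ n.
  X₀ : ℕ → ℤ → ℤ
  X₀ ρ n = + q * (+ ρ + + d * n) + + (q ℕ.+ 1) * (+ p * n)

  reduced-energy : ℕ → ℤ → ℤ
  reduced-energy ρ n = - (+ d * n) - + q * + ρ - residue-sum t (X₀ ρ n)

  energy-reduction : ∀ s → Bounded s → ∀ ρ n →
                     energy s (+ ρ + + d * (n + + carries s ρ)) ≡ reduced-energy ρ n
  energy-reduction s bs ρ n = begin
      energy s i
        ≡⟨ cong₂ (λ J K → - + (q ℕ.* q) * i - + d * J - + (q ℕ.+ 1) * K) J≡ K≡ ⟩
      - + (q ℕ.* q) * i - + d * (J₀ - + p * (+ (q ℕ.+ 1) * c)) - + (q ℕ.+ 1) * (- (+ p * (n + c)) - c)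
        ≡⟨ energy-identity (+ q) (+ ρ) n c J₀ ⟩
      reduced-energy ρ n ∎
    where
      open ≡-Reasoning
      c = + carries s ρ
      i = + ρ + + d * (n + c)
      J₀ = sumℤ (κs t (X₀ ρ n))
      K≡ : sumℤ (κs s i) ≡ - (+ p * (n + c)) - c
      K≡ = κs-sum-combine s bs ρ (n + c)
      X-identity : ∀ q ρ n c → let p = q - + 1 ; d = q * q + q in
        q * (ρ + d * (n + c)) - (q + + 1) * (- (p * (n + c)) - c)
          ≡ (q * (ρ + d * n) + (q + + 1) * (p * n)) + d * ((q + + 1) * c)
      X-identity = solve-∀
      X≡ : X s i ≡ X₀ ρ n + + d * (+ (q ℕ.+ 1) * c)
      X≡ = trans (cong (λ K → + q * i - + (q ℕ.+ 1) * K) K≡) (X-identity (+ q) (+ ρ) n c)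
      J≡ : sumℤ (κs t (X s i)) ≡ J₀ - + p * (+ (q ℕ.+ 1) * c)
      J≡ = trans (cong (sumℤ ∘ κs t) X≡) (κs-sum-shift t (X₀ ρ n) (+ (q ℕ.+ 1) * c))
      energy-identity : ∀ q ρ n c J₀ → let p = q - + 1 ; d = q * q + q in
        - (q * q) * (ρ + d * (n + c)) - d * (J₀ - p * ((q + + 1) * c)) - (q + + 1) * (- (p * (n + c)) - c)
          ≡ - (d * n) - q * ρ - (p * (q * (ρ + d * n) + (q + + 1) * (p * n)) + d * J₀)
      energy-identity = solve-∀

  module Bounds (t-bounded : Bounded t) where

    residue-bounds : ∀ x → (- (+ p * + d) ≤ residue-sum t x) × (residue-sum t x ≤ + p * + d)
    residue-bounds = residue-sum-bounds t t-bounded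

    reduced-energy-low : ∀ ρ n → ρ ℕ.< d → n < - + p → - uStar q ≤ reduced-energy ρ n
    reduced-energy-low ρ n ρ<d n<-p =
      ≤-by (0≤-+ (0≤-+ (0≤-+ (0≤-* (0≤+ d) (gap< n<-p)) (0≤-* (0≤+ q) (gap< (+<+ ρ<d))))
                       (gap≤ (proj₂ (residue-bounds (X₀ ρ n)))))
                 (0≤+ (d ℕ.+ q)))
           (certificate (+ q) (+ ρ) n (residue-sum t (X₀ ρ n)))
      where
        certificate : ∀ q ρ n R → let p = q - + 1 ; d = q * q + q in
          (- (d * n) - q * ρ - R) - - (q * q * q + q * q)
            ≡ d * (- p - (+ 1 + n)) + q * (d - (+ 1 + ρ)) + (p * d - R) + (d + q)
        certificate = solve-∀

    reduced-energy-high : ∀ ρ n u → + 0 ≤ u → u + + p * + d + + 1 ≤ n → reduced-energy ρ n < - u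
    reduced-energy-high ρ n u 0≤u h≤n =
      <-by (0≤-+ (0≤-+ (0≤-+ (gap≤ (proj₁ (residue-bounds (X₀ ρ n)))) (0≤-* (0≤+ q) (0≤+ ρ)))
                       (0≤-* (0≤+ d) (gap≤ h≤n)))
                 (0≤-* (0≤+ (q ℕ.* q ℕ.+ p)) (0≤-+ (0≤-+ 0≤u (0≤-* (0≤+ p) (0≤+ d))) (0≤+ 1))))
           (certificate (+ q) (+ ρ) n u (residue-sum t (X₀ ρ n)))
      where
        certificate : ∀ q ρ n u R → let p = q - + 1 ; d = q * q + q ; h = u + p * d + + 1 in
          - u - (+ 1 + (- (d * n) - q * ρ - R))
            ≡ (R - - (p * d)) + q * ρ + d * (n - h) + (q * q + p) * h
        certificate = solve-∀

  -- i = ρ + d(n + c) satisfies i ≥ -r* = -pd exactly when n ≥ -p - c.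
  lower-bound-shape : ∀ q ρ n c → let p = q - + 1 ; d = q * q + q in
    (ρ + d * (n + c)) - - (q * q * q - q) ≡ ρ + d * (n - (- p - c))
  lower-bound-shape = solve-∀

  lower-bound⇒ : ∀ {ρ} n c → ρ ℕ.< d → - rStar q ≤ + ρ + + d * (n + c) → - + p - c ≤ n
  lower-bound⇒ {ρ} n c ρ<d h = ℤP.0≤i-j⇒j≤i
    (nonneg-quotient (n - (- + p - c)) ρ<d (subst (+ 0 ≤_) (lower-bound-shape (+ q) (+ ρ) n c) (gap≤ h)))

  lower-bound⇐ : ∀ ρ n c → - + p - c ≤ n → - rStar q ≤ + ρ + + d * (n + c)
  lower-bound⇐ ρ n c h = ≤-by (0≤-+ (0≤+ ρ) (0≤-* (0≤+ d) (gap≤ h))) (lower-bound-shape (+ q) (+ ρ) n c)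

  module Counting (t-bounded : Bounded t) (u : ℤ) (u*≤u : uStar q ≤ u) where
    open Bounds t-bounded

    0≤u : + 0 ≤ u
    0≤u = ℤP.≤-trans (0≤+ _) u*≤u

    Admissible : Fin d → ℤ → Set
    Admissible ρ n = - u ≤ reduced-energy (toℕ ρ) n

    module Line (ρ : Fin d) =
      HalfLine (Admissible ρ) ℤP.≤-irrelevant (λ n → - u ℤP.≤? reduced-energy (toℕ ρ) n)

    Fibre : Fin d → ℕ → Set
    Fibre ρ c = Line.AtLeast ρ (- + p - + c)

    Admissible-point : Vec ℤ p → ℤ → Set
    Admissible-point s i = (- rStar q ≤ i) × (- u ≤ energy s i)

    fibre-iso : ∀ s → Bounded s → ∀ ρ →
                Σ ℤ (λ m → Admissible-point s (+ toℕ ρ + + d * m)) ↔ Fibre ρ (carries s (toℕ ρ))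
    fibre-iso s bs ρ = begin
        Σ ℤ (λ m → Admissible-point s (+ toℕ ρ + + d * m))
          ↔⟨ ↔-sym (Σ-↔ (shift↔ c) ↔-refl) ⟩
        Σ ℤ (λ n → Admissible-point s (+ toℕ ρ + + d * (n + c)))
          ↔⟨ Σ-↔ ↔-refl (props↔ ≤×≤-irrelevant ≤×≤-irrelevant to from) ⟩
        Fibre ρ (carries s (toℕ ρ))
          ∎
      where
        open EquationalReasoning {k = bijection}
        c = + carries s (toℕ ρ)
        reduction : ∀ n → energy s (+ toℕ ρ + + d * (n + c)) ≡ reduced-energy (toℕ ρ) n
        reduction = energy-reduction s bs (toℕ ρ)
        to : ∀ {n} → Admissible-point s (+ toℕ ρ + + d * (n + c)) → (- + p - c ≤ n) × Admissible ρ n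
        to {n} (r≤i , u≤) = lower-bound⇒ n c (toℕ<n ρ) r≤i , subst (- u ≤_) (reduction n) u≤
        from : ∀ {n} → (- + p - c ≤ n) × Admissible ρ n → Admissible-point s (+ toℕ ρ + + d * (n + c))
        from {n} (l , u≤) = lower-bound⇐ (toℕ ρ) n c l , subst (- u ≤_) (sym (reduction n)) u≤

    Ω-fibres : ∀ s → Bounded s → Ω q (rStar q) s t u ↔ Σ (Fin d) (λ ρ → Fibre ρ (carries s (toℕ ρ)))
    Ω-fibres s bs = begin
      Ω q (rStar q) s t u
        ↔⟨ Ω-by-i (rStar q) s u ⟩
      Σ ℤ (Admissible-point s)
        ↔⟨ ↔-sym (Σ-↔ combine↔ ↔-refl) ⟩
      Σ (Fin d × ℤ) (uncurry λ ρ m → Admissible-point s (+ toℕ ρ + + d * m))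
        ↔⟨ Σ-assoc ⟩
      Σ (Fin d) (λ ρ → Σ ℤ (λ m → Admissible-point s (+ toℕ ρ + + d * m)))
        ↔⟨ Σ-↔ ↔-refl (fibre-iso s bs _) ⟩
      Σ (Fin d) (λ ρ → Fibre ρ (carries s (toℕ ρ)))
        ∎
      where open EquationalReasoning {k = bijection}

    -- Only finitely many n ≥ -p are admissible ...
    base-finite : ∀ ρ → ∃[ k ] (Line.AtLeast ρ (- + p) ↔ Fin k)
    base-finite ρ = Line.finite ρ (- + p) (u + + p * + d + + 1)
      (≤-by (0≤-+ (0≤-+ (0≤-+ 0≤u (0≤-* (0≤+ p) (0≤+ d))) (0≤+ 1)) (0≤+ p)) (e u (+ p) (+ d)))
      (λ n h≤n → ℤP.<⇒≱ (reduced-energy-high (toℕ ρ) n u 0≤u h≤n))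
      where
        e : ∀ u p d → (u + p * d + + 1) - - p ≡ u + p * d + + 1 + p
        e = solve-∀

    base-size : Fin d → ℕ
    base-size ρ = proj₁ (base-finite ρ)

    -- ... while every n < -p is, so c carries add exactly c points to the fibre.
    fibre-size : ∀ ρ c → Fibre ρ c ↔ Fin (c ℕ.+ base-size ρ)
    fibre-size ρ c = Line.extend ρ (- + p) c
      (λ n n<-p → ℤP.≤-trans (ℤP.neg-mono-≤ u*≤u) (reduced-energy-low (toℕ ρ) n (toℕ<n ρ) n<-p))
      (proj₂ (base-finite ρ))

    size : Vec ℤ p → ℕ
    size s = sum (λ ρ → carries s (toℕ ρ) ℕ.+ base-size ρ)

    count : ∀ s → Bounded s → Ω q (rStar q) s t u ↔ Fin (size s)
    count s bs = Σ-Fin↔sum d _ (λ ρ → fibre-size ρ (carries s (toℕ ρ))) ↔-∘ Ω-fibres s bs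

    -- Since the carries add up to Σ_μ s_μ, the size is Σ_ρ base-size ρ + Σ_μ s_μ.
    size-formula : ∀ s → Bounded s → + size s ≡ + sum base-size + sumℤ s
    size-formula s bs = begin
      + size s                                ≡⟨ cong +_ (∑-distrib-+ carry base-size) ⟩
      + (sum carry ℕ.+ sum base-size)         ≡⟨ ℤP.pos-+ (sum carry) (sum base-size) ⟩
      + sum carry + + sum base-size           ≡⟨ cong (_+ + sum base-size) (total-carries s bs) ⟩
      sumℤ s + + sum base-size                ≡⟨ ℤP.+-comm (sumℤ s) (+ sum base-size) ⟩
      + sum base-size + sumℤ s                ∎
      where
        open ≡-Reasoning
        carry : Fin d → ℕ
        carry ρ = carries s (toℕ ρ)

zero-not-prime-power : ¬ IsPrimePower 0
zero-not-prime-power (p , k , p-prime , 0≡p^k+1) =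
  ¬prime[0] (subst Prime (ℕP.m^n≡0⇒m≡0 p (suc k) (sym 0≡p^k+1)) p-prime)

sumℤ-zeros : ∀ n → sumℤ (replicate n (+ 0)) ≡ + 0
sumℤ-zeros zero    = refl
sumℤ-zeros (suc n) = trans (ℤP.+-identityˡ _) (sumℤ-zeros n)

lemma3p5 : (q : ℕ) → IsPrimePower q →
    (s t : Vec ℤ (q ℕ.∸ 1)) → (u : ℤ) →
    ((μ : Fin (q ℕ.∸ 1)) → toℕ μ ≡ 0 → lookup s μ ≡ + 0) →
    ((μ : Fin (q ℕ.∸ 1)) → (+ 0 ≤ lookup s μ) × (lookup s μ < Q q)) →
    ((ν : Fin (q ℕ.∸ 1)) → (+ 0 ≤ lookup t ν) × (lookup t ν < Q q)) →
    uStar q ≤ u →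
    ∃[ N ] ∃[ M ]
      ((Fin N ↔ Ω q (rStar q) s t u)
      × (Fin M ↔ Ω q (rStar q) (zeros q) t u)
      × + N ≡ + M + sumℤ s)
lemma3p5 zero    q-prime-power = ⊥-elim (zero-not-prime-power q-prime-power)
lemma3p5 (suc p) _ s t u _ s-bounded t-bounded u*≤u =
  size s , size (zeros q) , ↔-sym (count s s-bounded) , ↔-sym (count (zeros q) zeros-bounded) ,
  size-difference
  where
    open Structure p t
    open Counting t-bounded u u*≤u
    zeros-bounded : Bounded (zeros q)
    zeros-bounded μ rewrite lookup-replicate μ (+ 0) = 0≤+ 0 , +<+ (ℕ.s≤s ℕ.z≤n)
    -- The zero vector has no carries, so #Ω_{r*,0,t,u} is the sum of the base sizes.
    size-zeros : + size (zeros q) ≡ + sum base-size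
    size-zeros = begin
      + size (zeros q)                  ≡⟨ size-formula (zeros q) zeros-bounded ⟩
      + sum base-size + sumℤ (zeros q)  ≡⟨ cong (λ z → + sum base-size + z) (sumℤ-zeros p) ⟩
      + sum base-size + + 0             ≡⟨ ℤP.+-identityʳ (+ sum base-size) ⟩
      + sum base-size                   ∎
      where open ≡-Reasoning
    size-difference : + size s ≡ + size (zeros q) + sumℤ s
    size-difference = trans (size-formula s s-bounded) (cong (_+ sumℤ s) (sym size-zeros))
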